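{- Let $M,N\geq 0$ be integers and let $k$ be a positive integer. Then: (i) if $|M-N|\leq k$, the trigonometric polynomial $$\sum_{l\in\mathbb{Z}}\binom{M+N}{M-kl}^2 \cos(lx)$$ is a polynomial in $1+\cos(x)$ with nonnegative integer coefficients; (ii) the trigonometric polynomial $$\sum_{l\in\mathbb{Z}}\binom{M+N}{M-kl}\binom{M+N}{N-kl} \cos(lx)$$ is a polynomial in $1+\cos(x)$ with nonnegative integer coefficients.
   Context: Binomial coefficients $\binom{n}{j}$ are taken to be $0$ when $j<0$ or $j>n$, so all sums over $l\in\mathbb{Z}$ are finite. -}

module Defs where

open import Data.Nat as ℕ using (ℕ; zero; suc)
open import Data.Nat.Combinatorics using (_C_)
open import Data.Integer using (ℤ; +_; -[1+_]; _+_; _-_; _*_; ∣_∣)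
open import Data.List using (List; []; _∷_)
open import Data.Product using (∃-syntax)
open import Relation.Binary.PropositionalEquality using (_≡_)

binomℤ : ℕ → ℤ → ℕ
binomℤ n (+ j)     = n C j
binomℤ n -[1+ _ ]  = 0

-- Chebyshev polynomials of the first kind evaluated at y:
-- cheb l (cos x) = cos (l x).
cheb : ℕ → ℤ → ℤ
cheb zero y = + 1
cheb (suc zero) y = y
cheb (suc (suc n)) y = + 2 * y * cheb (suc n) y - cheb n y

sumℕ : ℕ → (ℕ → ℤ) → ℤ
sumℕ zero f = + 0
sumℕ (suc n) f = sumℕ n f + f n

-- Evaluate Σ_{l = -L}^{L} c l · cos(l x) at cos x = y, i.e.
-- Σ_{l = -L}^{L} c l · T_{|l|}(y).
cosSum : ℕ → (ℤ → ℕ) → ℤ → ℤ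
cosSum L c y = sumℕ (suc (L ℕ.+ L)) (λ i → let l = + i - + L in + (c l) * cheb ∣ l ∣ y)

evalPoly : List ℕ → ℤ → ℤ
evalPoly [] t = + 0
evalPoly (p ∷ ps) t = + p + t * evalPoly ps t

-- Σ_{l=-L}^{L} c l cos(l x) is a polynomial in 1 + cos x with
-- nonnegative integer coefficients (identity of polynomials in y = cos x,
-- checked at every integer y, which determines the polynomial).
IsPolyIn1+cos : ℕ → (ℤ → ℕ) → Set
IsPolyIn1+cos L c = ∃[ ps ] (∀ (y : ℤ) → cosSum L c y ≡ evalPoly ps (+ 1 + y))

{-# OPTIONS --safe #-}
module Submission where

-- Write C(n,a) C(n,b) = Σ_i E(n,a+b,i) C(a+b-2i, a-i) with nonnegative trinomial weights E.  Both parts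
-- then reduce to the sums P = Σ_l C(m, A-kl) cos (l x) with m ≤ 2A ≤ m+k.  Writing y = cos x and
-- S = Σ_l C(m, A-kl) sin (l x) / sin x, induction on m shows that P and P + (1 - y) S are polynomials in
-- 1 + y with nonnegative coefficients.
-- Pascal's rule splits the coefficients at (m+1, A) into those at (m, A) and at (m, A-1).  If 2A = m+1,
-- the latter are the former reflected by l ↦ -l, so P doubles and S cancels.  If 2A = m+1+k, the former
-- are the latter shifted by l ↦ 1-l, and cos ((1-l) x) = cos x cos (l x) + sin x sin (l x) turns the sums
-- P₀, S₀ at (m, A-1) into P = (1 + y) (P₀ + (1 - y) S₀) and P + (1 - y) S = 2 (P₀ + (1 - y) S₀).
-- Part (i) with M < N follows from the case M ≥ N by l ↦ -l.

open import Data.List using (List; []; _∷_)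
open import Data.Nat as ℕ using (ℕ; zero; suc; _≤_; _<_; z≤n; s≤s; _≤?_)
import Data.Nat.Properties as ℕ
open import Data.Nat.Combinatorics using (_C_; nCk+nC[k+1]≡[n+1]C[k+1]; k>n⇒nCk≡0; nCk≡nC[n∸k])
open import Data.Integer as ℤ using (ℤ; +_; -[1+_]; _+_; _-_; _*_; -_; ∣_∣)
import Data.Integer.Properties as ℤ
open import Data.Integer.Tactic.RingSolver using (solve-∀)
open import Data.Nat.Tactic.RingSolver using () renaming (solve-∀ to ℕ-solve-∀)
open import Data.Product using (_×_; _,_; proj₁; proj₂)
open import Data.Sum using (inj₁; inj₂)
open import Relation.Nullary using (yes; no)
open import Relation.Binary.PropositionalEquality
open ≡-Reasoning

open import Defs

-- Binomial coefficients with an integer lower index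

x+y≡z⇒+z-+x≡+y : ∀ {x y z} → x ℕ.+ y ≡ z → + z - + x ≡ + y
x+y≡z⇒+z-+x≡+y {x} {y} refl = trans (cong (_- + x) (ℤ.pos-+ x y)) (lemma (+ x) (+ y))
  where
  lemma : ∀ a b → a + b - a ≡ b
  lemma = solve-∀

x<y⇒+x-+y≡-[1+y∸1+x] : ∀ {x y} → x < y → + x - + y ≡ -[1+ y ℕ.∸ suc x ]
x<y⇒+x-+y≡-[1+y∸1+x] {x} {y} x<y = begin
  + x - + y                       ≡⟨ cong (λ z → + x - + z) (sym y≡x+1+d) ⟩
  + x - (+ x + + suc d)           ≡⟨ lemma (+ x) (+ d) ⟩
  -[1+ d ]                        ∎
  where
  d : ℕ
  d = y ℕ.∸ suc x
  y≡x+1+d : x ℕ.+ suc d ≡ y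
  y≡x+1+d = trans (ℕ.+-suc x d) (ℕ.m+[n∸m]≡n x<y)
  lemma : ∀ a b → a - (a + (+ 1 + b)) ≡ - (+ 1 + b)
  lemma = solve-∀

binomℤ-pascal : ∀ m j → binomℤ (suc m) j ≡ binomℤ m j ℕ.+ binomℤ m (j - + 1)
binomℤ-pascal m (+ zero)  = refl
binomℤ-pascal m (+ suc j) = trans (sym (nCk+nC[k+1]≡[n+1]C[k+1] m j)) (ℕ.+-comm (m C j) (m C suc j))
binomℤ-pascal m -[1+ j ]  = refl

binomℤ-above : ∀ m {j} → m < j → binomℤ m (+ j) ≡ 0
binomℤ-above m = k>n⇒nCk≡0

binomℤ-below : ∀ m {a b} → a < b → binomℤ m (+ a - + b) ≡ 0
binomℤ-below m a<b = cong (binomℤ m) (x<y⇒+x-+y≡-[1+y∸1+x] a<b)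

binomℤ-sym : ∀ m j → binomℤ m j ≡ binomℤ m (+ m - j)
binomℤ-sym m (+ j) with j ≤? m
... | yes j≤m = trans (nCk≡nC[n∸k] j≤m) (cong (binomℤ m) (sym (x+y≡z⇒+z-+x≡+y {j} (ℕ.m+[n∸m]≡n j≤m))))
... | no  j≰m = trans (binomℤ-above m (ℕ.≰⇒> j≰m)) (sym (binomℤ-below m (ℕ.≰⇒> j≰m)))
binomℤ-sym m -[1+ j ] = sym (binomℤ-above m (ℕ.m<m+n m ℕ.z<s))

binomℤ-complement : ∀ {a b n} → a ℕ.+ b ≡ n → ∀ j → binomℤ n (+ a - j) ≡ binomℤ n (+ b + j)
binomℤ-complement {a} {b} {n} refl j = trans (binomℤ-sym n (+ a - j)) (cong (binomℤ n) (begin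
  + (a ℕ.+ b) - (+ a - j)  ≡⟨ cong (_- (+ a - j)) (ℤ.pos-+ a b) ⟩
  + a + + b - (+ a - j)    ≡⟨ lemma (+ a) (+ b) j ⟩
  + b + j                  ∎))
  where
  lemma : ∀ a b j → a + b - (a - j) ≡ b + j
  lemma = solve-∀

-- Polynomials in 1 + y with nonnegative coefficients

infixl 6 _+ₚ_

_+ₚ_ : List ℕ → List ℕ → List ℕ
[]       +ₚ q        = q
(a ∷ p)  +ₚ []       = a ∷ p
(a ∷ p)  +ₚ (b ∷ q)  = (a ℕ.+ b) ∷ (p +ₚ q)

_·ₚ_ : ℕ → List ℕ → List ℕ
c ·ₚ []      = []
c ·ₚ (a ∷ p) = (c ℕ.* a) ∷ (c ·ₚ p)

evalPoly-+ₚ : ∀ p q t → evalPoly (p +ₚ q) t ≡ evalPoly p t + evalPoly q t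
evalPoly-+ₚ []      q       t = sym (ℤ.+-identityˡ _)
evalPoly-+ₚ (a ∷ p) []      t = sym (ℤ.+-identityʳ _)
evalPoly-+ₚ (a ∷ p) (b ∷ q) t = begin
  + (a ℕ.+ b) + t * evalPoly (p +ₚ q) t                 ≡⟨ cong₂ (λ u v → u + t * v) (ℤ.pos-+ a b) (evalPoly-+ₚ p q t) ⟩
  + a + + b + t * (evalPoly p t + evalPoly q t)         ≡⟨ lemma (+ a) (+ b) t (evalPoly p t) (evalPoly q t) ⟩
  (+ a + t * evalPoly p t) + (+ b + t * evalPoly q t)   ∎
  where
  lemma : ∀ x y s u v → x + y + s * (u + v) ≡ (x + s * u) + (y + s * v)
  lemma = solve-∀

evalPoly-·ₚ : ∀ c p t → evalPoly (c ·ₚ p) t ≡ + c * evalPoly p t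
evalPoly-·ₚ c []      t = sym (ℤ.*-zeroʳ (+ c))
evalPoly-·ₚ c (a ∷ p) t = begin
  + (c ℕ.* a) + t * evalPoly (c ·ₚ p) t    ≡⟨ cong₂ (λ u v → u + t * v) (ℤ.pos-* c a) (evalPoly-·ₚ c p t) ⟩
  + c * + a + t * (+ c * evalPoly p t)     ≡⟨ lemma (+ c) (+ a) t (evalPoly p t) ⟩
  + c * (+ a + t * evalPoly p t)           ∎
  where
  lemma : ∀ x y s u → x * y + s * (x * u) ≡ x * (y + s * u)
  lemma = solve-∀

record IsPolyIn1+ (f : ℤ → ℤ) : Set where
  constructor poly
  field
    coefficients : List ℕ
    evaluation   : ∀ y → f y ≡ evalPoly coefficients (+ 1 + y)

IsPolyIn1+-resp : ∀ {f g : ℤ → ℤ} → (∀ y → f y ≡ g y) → IsPolyIn1+ g → IsPolyIn1+ f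
IsPolyIn1+-resp f≗g (poly ps g≡ps) = poly ps (λ y → trans (f≗g y) (g≡ps y))

IsPolyIn1+-0 : IsPolyIn1+ (λ _ → + 0)
IsPolyIn1+-0 = poly [] (λ _ → refl)

IsPolyIn1+-+ : ∀ {f g : ℤ → ℤ} → IsPolyIn1+ f → IsPolyIn1+ g → IsPolyIn1+ (λ y → f y + g y)
IsPolyIn1+-+ (poly ps f≡ps) (poly qs g≡qs) =
  poly (ps +ₚ qs) (λ y → trans (cong₂ _+_ (f≡ps y) (g≡qs y)) (sym (evalPoly-+ₚ ps qs _)))

IsPolyIn1+-scale : ∀ c {f : ℤ → ℤ} → IsPolyIn1+ f → IsPolyIn1+ (λ y → + c * f y)
IsPolyIn1+-scale c (poly ps f≡ps) = poly (c ·ₚ ps) (λ y → trans (cong (+ c *_) (f≡ps y)) (sym (evalPoly-·ₚ c ps _)))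

IsPolyIn1+-*1+ : ∀ {f : ℤ → ℤ} → IsPolyIn1+ f → IsPolyIn1+ (λ y → (+ 1 + y) * f y)
IsPolyIn1+-*1+ (poly ps f≡ps) = poly (0 ∷ ps) (λ y → trans (cong ((+ 1 + y) *_) (f≡ps y)) (sym (ℤ.+-identityˡ _)))

IsPolyIn1+-sumℕ : ∀ m (w : ℕ → ℕ) {F : ℕ → ℤ → ℤ} → (∀ i → IsPolyIn1+ (F i)) →
                  IsPolyIn1+ (λ y → sumℕ m (λ i → + w i * F i y))
IsPolyIn1+-sumℕ zero    w F-poly = IsPolyIn1+-0
IsPolyIn1+-sumℕ (suc m) w F-poly = IsPolyIn1+-+ (IsPolyIn1+-sumℕ m w F-poly) (IsPolyIn1+-scale (w m) (F-poly m))

sumℕ-cong : ∀ n {f g : ℕ → ℤ} → (∀ i → f i ≡ g i) → sumℕ n f ≡ sumℕ n g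
sumℕ-cong zero    f≗g = refl
sumℕ-cong (suc n) f≗g = cong₂ _+_ (sumℕ-cong n f≗g) (f≗g n)

sumℕ-+ : ∀ n (f g : ℕ → ℤ) → sumℕ n (λ i → f i + g i) ≡ sumℕ n f + sumℕ n g
sumℕ-+ zero    f g = refl
sumℕ-+ (suc n) f g = trans (cong (_+ (f n + g n)) (sumℕ-+ n f g)) (lemma (sumℕ n f) (sumℕ n g) (f n) (g n))
  where
  lemma : ∀ a b c d → a + b + (c + d) ≡ a + c + (b + d)
  lemma = solve-∀

sumℕ-*ˡ : ∀ n c (f : ℕ → ℤ) → sumℕ n (λ i → c * f i) ≡ c * sumℕ n f
sumℕ-*ˡ zero    c f = sym (ℤ.*-zeroʳ c)
sumℕ-*ˡ (suc n) c f = trans (cong (_+ c * f n) (sumℕ-*ˡ n c f)) (sym (ℤ.*-distribˡ-+ c (sumℕ n f) (f n)))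

sumℕ-suc : ∀ n (f : ℕ → ℤ) → sumℕ (suc n) f ≡ f 0 + sumℕ n (λ i → f (suc i))
sumℕ-suc zero    f = trans (ℤ.+-identityˡ (f 0)) (sym (ℤ.+-identityʳ (f 0)))
sumℕ-suc (suc n) f = trans (cong (_+ f (suc n)) (sumℕ-suc n f)) (ℤ.+-assoc (f 0) _ _)

symSum : ℕ → (ℤ → ℤ) → ℤ
symSum zero    g = g (+ 0)
symSum (suc B) g = symSum B g + (g -[1+ B ] + g (+ suc B))

symSum-cong : ∀ B {g h : ℤ → ℤ} → (∀ l → g l ≡ h l) → symSum B g ≡ symSum B h
symSum-cong zero    g≗h = g≗h (+ 0)
symSum-cong (suc B) g≗h = cong₂ _+_ (symSum-cong B g≗h) (cong₂ _+_ (g≗h _) (g≗h _))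

symSum-+ : ∀ B (g h : ℤ → ℤ) → symSum B (λ l → g l + h l) ≡ symSum B g + symSum B h
symSum-+ zero    g h = refl
symSum-+ (suc B) g h = trans (cong (_+ (g -[1+ B ] + h -[1+ B ] + (g (+ suc B) + h (+ suc B)))) (symSum-+ B g h))
  (lemma (symSum B g) (symSum B h) (g -[1+ B ]) (h -[1+ B ]) (g (+ suc B)) (h (+ suc B)))
  where
  lemma : ∀ a b c d e f → a + b + (c + d + (e + f)) ≡ a + (c + e) + (b + (d + f))
  lemma = solve-∀

symSum-*ˡ : ∀ B c (g : ℤ → ℤ) → symSum B (λ l → c * g l) ≡ c * symSum B g
symSum-*ˡ zero    c g = refl
symSum-*ˡ (suc B) c g = trans (cong (_+ (c * g -[1+ B ] + c * g (+ suc B))) (symSum-*ˡ B c g))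
                              (lemma c (symSum B g) (g -[1+ B ]) (g (+ suc B)))
  where
  lemma : ∀ c a b d → c * a + (c * b + c * d) ≡ c * (a + (b + d))
  lemma = solve-∀

symSum-sumℕ : ∀ B m (G : ℕ → ℤ → ℤ) → symSum B (λ l → sumℕ m (λ i → G i l)) ≡ sumℕ m (λ i → symSum B (G i))
symSum-sumℕ B zero    G = trans (symSum-*ˡ B (+ 0) (λ _ → + 0)) (ℤ.*-zeroˡ (symSum B (λ _ → + 0)))
symSum-sumℕ B (suc m) G = trans (symSum-+ B (λ l → sumℕ m (λ i → G i l)) (G m)) (cong (_+ symSum B (G m)) (symSum-sumℕ B m G))

symSum-reflect : ∀ B (g : ℤ → ℤ) → symSum B (λ l → g (- l)) ≡ symSum B g
symSum-reflect zero    g = refl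
symSum-reflect (suc B) g = cong₂ _+_ (symSum-reflect B g) (ℤ.+-comm (g (+ suc B)) (g -[1+ B ]))

symSum-reflect-shift : ∀ B (g : ℤ → ℤ) →
  symSum (suc B) (λ l → g (+ 1 - l)) ≡ symSum B g + (g (+ suc B) + g (+ suc (suc B)))
symSum-reflect-shift zero    g = lemma (g (+ 0)) (g (+ 1)) (g (+ 2))
  where
  lemma : ∀ a b c → b + (c + a) ≡ a + (b + c)
  lemma = solve-∀
symSum-reflect-shift (suc B) g = begin
  symSum (suc B) (λ l → g (+ 1 - l)) + (g (+ suc (suc (suc B))) + g -[1+ B ])
    ≡⟨ cong (_+ (g (+ suc (suc (suc B))) + g -[1+ B ])) (symSum-reflect-shift B g) ⟩
  symSum B g + (g (+ suc B) + g (+ suc (suc B))) + (g (+ suc (suc (suc B))) + g -[1+ B ])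
    ≡⟨ lemma (symSum B g) (g -[1+ B ]) (g (+ suc B)) (g (+ suc (suc B))) (g (+ suc (suc (suc B)))) ⟩
  symSum B g + (g -[1+ B ] + g (+ suc B)) + (g (+ suc (suc B)) + g (+ suc (suc (suc B))))
    ∎
  where
  lemma : ∀ s a b c d → s + (b + c) + (d + a) ≡ s + (a + b) + (c + d)
  lemma = solve-∀

sumℕ-centred : ∀ L (g : ℤ → ℤ) → sumℕ (suc (L ℕ.+ L)) (λ i → g (+ i - + L)) ≡ symSum L g
sumℕ-centred zero    g = ℤ.+-identityˡ (g (+ 0))
sumℕ-centred (suc L) g = begin
  sumℕ (suc (suc L ℕ.+ suc L)) f
    ≡⟨ cong (λ n → sumℕ (suc (suc n)) f) (ℕ.+-suc L L) ⟩
  sumℕ (suc (suc (L ℕ.+ L))) f + f (suc (suc (L ℕ.+ L)))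
    ≡⟨ cong₂ _+_ (sumℕ-suc (suc (L ℕ.+ L)) f) (cong g top) ⟩
  g -[1+ L ] + sumℕ (suc (L ℕ.+ L)) (λ i → f (suc i)) + g (+ suc L)
    ≡⟨ cong (λ s → g -[1+ L ] + s + g (+ suc L)) (trans (sumℕ-cong (suc (L ℕ.+ L)) shift) (sumℕ-centred L g)) ⟩
  g -[1+ L ] + symSum L g + g (+ suc L)
    ≡⟨ lemma (g -[1+ L ]) (symSum L g) (g (+ suc L)) ⟩
  symSum L g + (g -[1+ L ] + g (+ suc L))
    ∎
  where
  f : ℕ → ℤ
  f i = g (+ i - + suc L)
  shift : ∀ i → f (suc i) ≡ g (+ i - + L)
  shift i = cong g (trans (ℤ.m-n≡m⊖n (suc i) (suc L))
                   (trans (ℤ.[1+m]⊖[1+n]≡m⊖n i L) (sym (ℤ.m-n≡m⊖n i L))))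
  top : + suc (suc (L ℕ.+ L)) - + suc L ≡ + suc L
  top = x+y≡z⇒+z-+x≡+y {suc L} (cong suc (ℕ.+-suc L L))
  lemma : ∀ a s b → a + s + b ≡ s + (a + b)
  lemma = solve-∀

Supported : ℕ → (ℤ → ℕ) → Set
Supported B c = ∀ l → B < ∣ l ∣ → c l ≡ 0

weightedSum : ℕ → (ℤ → ℕ) → (ℤ → ℤ) → ℤ
weightedSum B c κ = symSum B (λ l → + c l * κ l)

cosSum≡weightedSum : ∀ L c y → cosSum L c y ≡ weightedSum L c (λ l → cheb ∣ l ∣ y)
cosSum≡weightedSum L c y = sumℕ-centred L (λ l → + c l * cheb ∣ l ∣ y)

module _ (B : ℕ) where

  weightedSum-congˡ : ∀ {c d} κ → (∀ l → c l ≡ d l) → weightedSum B c κ ≡ weightedSum B d κ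
  weightedSum-congˡ κ c≗d = symSum-cong B (λ l → cong (λ u → + u * κ l) (c≗d l))

  weightedSum-congʳ : ∀ c {κ κ′} → (∀ l → κ l ≡ κ′ l) → weightedSum B c κ ≡ weightedSum B c κ′
  weightedSum-congʳ c κ≗κ′ = symSum-cong B (λ l → cong (+ c l *_) (κ≗κ′ l))

  weightedSum-zero : ∀ {c} κ → (∀ l → c l ≡ 0) → weightedSum B c κ ≡ + 0
  weightedSum-zero κ c≗0 = trans (weightedSum-congˡ κ c≗0) (trans (symSum-*ˡ B (+ 0) κ) (ℤ.*-zeroˡ (symSum B κ)))

  weightedSum-+ˡ : ∀ c d κ → weightedSum B (λ l → c l ℕ.+ d l) κ ≡ weightedSum B c κ + weightedSum B d κ
  weightedSum-+ˡ c d κ = trans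
    (symSum-cong B (λ l → trans (cong (_* κ l) (ℤ.pos-+ (c l) (d l))) (ℤ.*-distribʳ-+ (κ l) (+ c l) (+ d l))))
    (symSum-+ B (λ l → + c l * κ l) (λ l → + d l * κ l))

  weightedSum-+ʳ : ∀ c κ₁ κ₂ → weightedSum B c (λ l → κ₁ l + κ₂ l) ≡ weightedSum B c κ₁ + weightedSum B c κ₂
  weightedSum-+ʳ c κ₁ κ₂ = trans (symSum-cong B (λ l → ℤ.*-distribˡ-+ (+ c l) (κ₁ l) (κ₂ l)))
                                 (symSum-+ B (λ l → + c l * κ₁ l) (λ l → + c l * κ₂ l))

  weightedSum-*ʳ : ∀ c a κ → weightedSum B c (λ l → a * κ l) ≡ a * weightedSum B c κ
  weightedSum-*ʳ c a κ = trans (symSum-cong B (λ l → lemma (+ c l) a (κ l))) (symSum-*ˡ B a (λ l → + c l * κ l))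
    where
    lemma : ∀ x a y → x * (a * y) ≡ a * (x * y)
    lemma = solve-∀

  weightedSum-reflect : ∀ c κ → weightedSum B (λ l → c (- l)) κ ≡ weightedSum B c (λ l → κ (- l))
  weightedSum-reflect c κ = trans
    (symSum-cong B (λ l → cong (λ u → + c (- l) * κ u) (sym (ℤ.neg-involutive l))))
    (symSum-reflect B (λ l → + c l * κ (- l)))

  weightedSum-expand : ∀ m {c} (w : ℕ → ℕ) (h : ℕ → ℤ → ℕ) κ →
                       (∀ l → + c l ≡ sumℕ m (λ i → + w i * + h i l)) →
                       weightedSum B c κ ≡ sumℕ m (λ i → + w i * weightedSum B (h i) κ)
  weightedSum-expand m {c} w h κ c≡Σ = begin
    symSum B (λ l → + c l * κ l)
      ≡⟨ symSum-cong B (λ l → trans (cong (_* κ l) (c≡Σ l)) (sumℕ-*ʳ l)) ⟩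
    symSum B (λ l → sumℕ m (λ i → + w i * (+ h i l * κ l)))
      ≡⟨ symSum-sumℕ B m (λ i l → + w i * (+ h i l * κ l)) ⟩
    sumℕ m (λ i → symSum B (λ l → + w i * (+ h i l * κ l)))
      ≡⟨ sumℕ-cong m (λ i → symSum-*ˡ B (+ w i) (λ l → + h i l * κ l)) ⟩
    sumℕ m (λ i → + w i * weightedSum B (h i) κ)
      ∎
    where
    sumℕ-*ʳ : ∀ l → sumℕ m (λ i → + w i * + h i l) * κ l ≡ sumℕ m (λ i → + w i * (+ h i l * κ l))
    sumℕ-*ʳ l = trans (ℤ.*-comm _ (κ l)) (trans (sym (sumℕ-*ˡ m (κ l) (λ i → + w i * + h i l)))
                  (sumℕ-cong m (λ i → trans (ℤ.*-comm (κ l) _) (ℤ.*-assoc (+ w i) (+ h i l) (κ l)))))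

weightedSum-extend : ∀ {B B′ c} κ → Supported B c → B ≤ B′ → weightedSum B′ c κ ≡ weightedSum B c κ
weightedSum-extend {B} {c = c} κ c-supp B≤B′ = go (ℕ.≤⇒≤′ B≤B′)
  where
  vanish : ∀ l → + c l ≡ + 0 → + c l * κ l ≡ + 0
  vanish l c≡0 = trans (cong (_* κ l) c≡0) (ℤ.*-zeroˡ (κ l))
  go : ∀ {B′} → B ℕ.≤′ B′ → weightedSum B′ c κ ≡ weightedSum B c κ
  go ℕ.≤′-refl = refl
  go {suc B′} (ℕ.≤′-step B≤′B′) = begin
    weightedSum B′ c κ + (+ c -[1+ B′ ] * κ -[1+ B′ ] + + c (+ suc B′) * κ (+ suc B′))
      ≡⟨ cong₂ (λ u v → weightedSum B′ c κ + (u + v))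
               (vanish _ (cong +_ (c-supp _ B<1+B′))) (vanish _ (cong +_ (c-supp _ B<1+B′))) ⟩
    weightedSum B′ c κ + + 0
      ≡⟨ ℤ.+-identityʳ _ ⟩
    weightedSum B′ c κ
      ≡⟨ go B≤′B′ ⟩
    weightedSum B c κ
      ∎
    where
    B<1+B′ : B < suc B′
    B<1+B′ = s≤s (ℕ.≤′⇒≤ B≤′B′)

weightedSum-reflect-shift : ∀ {B c} κ → Supported B c →
  weightedSum (suc B) (λ l → c (+ 1 - l)) κ ≡ weightedSum B c (λ l → κ (+ 1 - l))
weightedSum-reflect-shift {B} {c} κ c-supp = begin
  symSum (suc B) (λ l → + c (+ 1 - l) * κ l)
    ≡⟨ symSum-cong (suc B) (λ l → cong (λ u → + c (+ 1 - l) * κ u) (sym (lemma l))) ⟩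
  symSum (suc B) (λ l → g (+ 1 - l))
    ≡⟨ symSum-reflect-shift B g ⟩
  symSum B g + (g (+ suc B) + g (+ suc (suc B)))
    ≡⟨ cong₂ (λ u v → symSum B g + (u + v)) (vanish (ℕ.n<1+n B)) (vanish (ℕ.m<n⇒m<1+n (ℕ.n<1+n B))) ⟩
  symSum B g + (+ 0 + + 0)
    ≡⟨ ℤ.+-identityʳ _ ⟩
  symSum B g
    ∎
  where
  g : ℤ → ℤ
  g l = + c l * κ (+ 1 - l)
  lemma : ∀ l → + 1 - (+ 1 - l) ≡ l
  lemma = solve-∀
  vanish : ∀ {t} → B < t → g (+ t) ≡ + 0
  vanish {t} B<t = trans (cong (λ u → + u * κ (+ 1 - + t)) (c-supp (+ t) B<t)) (ℤ.*-zeroˡ (κ (+ 1 - + t)))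

-- Expanding a product of two binomial coefficients

binomℤℤ : ℤ → ℤ → ℕ
binomℤℤ (+ m)    j = binomℤ m j
binomℤℤ -[1+ _ ] _ = 0

atPred : (ℕ → ℕ) → ℕ → ℕ
atPred f zero    = 0
atPred f (suc i) = f i

-- trinomial n s i is the coefficient of x^s q^i in (1 + x + q x²)^n.
trinomial : ℕ → ℤ → ℕ → ℕ
trinomial zero    (+ zero) zero = 1
trinomial zero    _        _    = 0
trinomial (suc n) s        i    = trinomial n s i ℕ.+ trinomial n (s - + 1) i ℕ.+ atPred (trinomial n (s - + 2)) i

trinomial-vanish : ∀ n {s} i {u} → s - (+ i + + i) ≡ -[1+ u ] → trinomial n s i ≡ 0
trinomial-vanish zero    {+ zero}   zero    ()
trinomial-vanish zero    {+ zero}   (suc i) _ = refl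
trinomial-vanish zero    {+ suc s}  i       _ = refl
trinomial-vanish zero    { -[1+ s ]} i      _ = refl
trinomial-vanish (suc n) {s}        i {u} s-2i<0 =
  cong₂ ℕ._+_ (cong₂ ℕ._+_ (trinomial-vanish n i s-2i<0) (trinomial-vanish n i s-1-2i<0)) (atPred-vanish i refl)
  where
  lemma₁ : ∀ s t → s - + 1 - t ≡ s - t - + 1
  lemma₁ = solve-∀
  s-1-2i<0 : s - + 1 - (+ i + + i) ≡ -[1+ suc u ]
  s-1-2i<0 = trans (lemma₁ s (+ i + + i)) (trans (cong (_- + 1) s-2i<0) (cong (λ x → -[1+ suc x ]) (ℕ.+-identityʳ u)))
  lemma₂ : ∀ s j → s - + 2 - (j + j) ≡ s - ((+ 1 + j) + (+ 1 + j))
  lemma₂ = solve-∀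
  atPred-vanish : ∀ j → j ≡ i → atPred (trinomial n (s - + 2)) j ≡ 0
  atPred-vanish zero    _    = refl
  atPred-vanish (suc j) refl = trinomial-vanish n j (trans (lemma₂ s (+ j)) s-2i<0)

trinomial-top : ∀ n s {i} → n < i → trinomial n s i ≡ 0
trinomial-top zero    (+ zero)   {suc i} _ = refl
trinomial-top zero    (+ suc s)  _       = refl
trinomial-top zero    -[1+ s ]   _       = refl
trinomial-top (suc n) s        {suc i} (s≤s n<i) =
  cong₂ ℕ._+_ (cong₂ ℕ._+_ (trinomial-top n s (ℕ.m<n⇒m<1+n n<i)) (trinomial-top n (s - + 1) (ℕ.m<n⇒m<1+n n<i)))
              (trinomial-top n (s - + 2) n<i)

expansionTerm : ℕ → ℤ → ℤ → ℕ → ℤ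
expansionTerm n s a i = + trinomial n s i * + binomℤℤ (s - (+ i + + i)) (a - + i)

expansion : ℕ → ℤ → ℤ → ℤ
expansion n s a = sumℕ (suc n) (expansionTerm n s a)

weighted-pascal : ∀ e {v} → (∀ {u} → v ≡ -[1+ u ] → e ≡ 0) → ∀ a →
  + e * + binomℤℤ (v + + 1) a ≡ + e * + binomℤℤ v a + + e * + binomℤℤ v (a - + 1)
weighted-pascal e {+ u}      _   a = begin
  + e * + binomℤ (u ℕ.+ 1) a                      ≡⟨ cong (λ m → + e * + binomℤ m a) (ℕ.+-comm u 1) ⟩
  + e * + binomℤ (suc u) a                        ≡⟨ cong (λ x → + e * + x) (binomℤ-pascal u a) ⟩
  + e * + (binomℤ u a ℕ.+ binomℤ u (a - + 1))     ≡⟨ cong (+ e *_) (ℤ.pos-+ (binomℤ u a) (binomℤ u (a - + 1))) ⟩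
  + e * (+ binomℤ u a + + binomℤ u (a - + 1))     ≡⟨ ℤ.*-distribˡ-+ (+ e) (+ binomℤ u a) (+ binomℤ u (a - + 1)) ⟩
  + e * + binomℤ u a + + e * + binomℤ u (a - + 1) ∎
weighted-pascal e { -[1+ u ]} e≡0 a rewrite e≡0 refl = refl

sumℕ-top : ∀ n (f : ℕ → ℤ) → f n ≡ + 0 → sumℕ (suc n) f ≡ sumℕ n f
sumℕ-top n f fn≡0 = trans (cong (λ x → sumℕ n f + x) fn≡0) (ℤ.+-identityʳ (sumℕ n f))

expansion-top : ∀ n s (β : ℕ → ℤ) →
                sumℕ (suc (suc n)) (λ i → + trinomial n s i * β i) ≡ sumℕ (suc n) (λ i → + trinomial n s i * β i)
expansion-top n s β =
  sumℕ-top (suc n) (λ i → + trinomial n s i * β i) (cong (λ e → + e * β (suc n)) (trinomial-top n s (ℕ.n<1+n n)))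

expansion-suc : ∀ n s a → expansion (suc n) s a
                ≡ expansion n s a + (expansion n (s - + 1) a + expansion n (s - + 1) (a - + 1)) + expansion n (s - + 2) (a - + 1)
expansion-suc n s a = begin
  sumℕ (suc (suc n)) (expansionTerm (suc n) s a)
    ≡⟨ sumℕ-cong (suc (suc n)) split ⟩
  sumℕ (suc (suc n)) (λ i → term₁ i + term₂ i + term₃ i)
    ≡⟨ trans (sumℕ-+ (suc (suc n)) (λ i → term₁ i + term₂ i) term₃)
             (cong (_+ sumℕ (suc (suc n)) term₃) (sumℕ-+ (suc (suc n)) term₁ term₂)) ⟩
  sumℕ (suc (suc n)) term₁ + sumℕ (suc (suc n)) term₂ + sumℕ (suc (suc n)) term₃
    ≡⟨ cong₂ _+_ (cong₂ _+_ (expansion-top n s β) (trans (expansion-top n (s - + 1) β) pascal)) lowering ⟩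
  expansion n s a + (expansion n (s - + 1) a + expansion n (s - + 1) (a - + 1)) + expansion n (s - + 2) (a - + 1)
    ∎
  where
  β : ℕ → ℤ
  β i = + binomℤℤ (s - (+ i + + i)) (a - + i)
  term₁ term₂ term₃ : ℕ → ℤ
  term₁ i = + trinomial n s i * β i
  term₂ i = + trinomial n (s - + 1) i * β i
  term₃ i = + atPred (trinomial n (s - + 2)) i * β i
  split : ∀ i → expansionTerm (suc n) s a i ≡ term₁ i + term₂ i + term₃ i
  split i = trans (cong (_* β i) (trans (ℤ.pos-+ (e₁ ℕ.+ e₂) e₃) (cong (_+ + e₃) (ℤ.pos-+ e₁ e₂))))
                  (trans (ℤ.*-distribʳ-+ (β i) (+ e₁ + + e₂) (+ e₃))
                         (cong (_+ term₃ i) (ℤ.*-distribʳ-+ (β i) (+ e₁) (+ e₂))))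
    where
    e₁ e₂ e₃ : ℕ
    e₁ = trinomial n s i
    e₂ = trinomial n (s - + 1) i
    e₃ = atPred (trinomial n (s - + 2)) i
  index₁ : ∀ s t → s - t ≡ s - + 1 - t + + 1
  index₁ = solve-∀
  index₂ : ∀ a i → a - i - + 1 ≡ a - + 1 - i
  index₂ = solve-∀
  pascal-term : ∀ i → term₂ i ≡ expansionTerm n (s - + 1) a i + expansionTerm n (s - + 1) (a - + 1) i
  pascal-term i = begin
    e * + binomℤℤ (s - (+ i + + i)) (a - + i)
      ≡⟨ cong (λ v → e * + binomℤℤ v (a - + i)) (index₁ s (+ i + + i)) ⟩
    e * + binomℤℤ (t + + 1) (a - + i)
      ≡⟨ weighted-pascal (trinomial n (s - + 1) i) (trinomial-vanish n i) (a - + i) ⟩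
    e * + binomℤℤ t (a - + i) + e * + binomℤℤ t (a - + i - + 1)
      ≡⟨ cong (λ x → e * + binomℤℤ t (a - + i) + e * + binomℤℤ t x) (index₂ a (+ i)) ⟩
    e * + binomℤℤ t (a - + i) + e * + binomℤℤ t (a - + 1 - + i)
      ∎
    where
    e t : ℤ
    e = + trinomial n (s - + 1) i
    t = s - + 1 - (+ i + + i)
  pascal : sumℕ (suc n) term₂ ≡ expansion n (s - + 1) a + expansion n (s - + 1) (a - + 1)
  pascal = trans (sumℕ-cong (suc n) pascal-term)
                 (sumℕ-+ (suc n) (expansionTerm n (s - + 1) a) (expansionTerm n (s - + 1) (a - + 1)))
  index₃ : ∀ s i → s - ((+ 1 + i) + (+ 1 + i)) ≡ s - + 2 - (i + i)
  index₃ = solve-∀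
  index₄ : ∀ a i → a - (+ 1 + i) ≡ a - + 1 - i
  index₄ = solve-∀
  lowering : sumℕ (suc (suc n)) term₃ ≡ expansion n (s - + 2) (a - + 1)
  lowering = trans (sumℕ-suc (suc n) term₃) (trans (ℤ.+-identityˡ _)
               (sumℕ-cong (suc n) (λ i → cong₂ (λ v x → + trinomial n (s - + 2) i * + binomℤℤ v x)
                                              (index₃ s (+ i)) (index₄ a (+ i)))))

binomℤ-product : ∀ n a b → + binomℤ n a * + binomℤ n b ≡ expansion n (a + b) a
binomℤ-product zero a b = trans (single-term a b) (sym (trans (ℤ.+-identityˡ _)
  (cong₂ (λ v x → + trinomial 0 (a + b) 0 * + binomℤℤ v x) (ℤ.+-identityʳ (a + b)) (ℤ.+-identityʳ a))))
  where
  single-term : ∀ a b → + binomℤ 0 a * + binomℤ 0 b ≡ + trinomial 0 (a + b) 0 * + binomℤℤ (a + b) a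
  single-term (+ zero) (+ zero)   = refl
  single-term (+ zero) (+ suc _)  = refl
  single-term (+ zero) -[1+ _ ]   = refl
  single-term (+ suc j) b with + suc j + b
  ... | + zero   = refl
  ... | + suc _  = refl
  ... | -[1+ _ ] = refl
  single-term -[1+ j ] b with -[1+ j ] + b
  ... | + zero   = refl
  ... | + suc _  = refl
  ... | -[1+ _ ] = refl
binomℤ-product (suc n) a b = begin
  + binomℤ (suc n) a * + binomℤ (suc n) b
    ≡⟨ cong₂ _*_ (pascal a) (pascal b) ⟩
  (+ binomℤ n a + + binomℤ n a₁) * (+ binomℤ n b + + binomℤ n b₁)
    ≡⟨ expand (+ binomℤ n a) (+ binomℤ n a₁) (+ binomℤ n b) (+ binomℤ n b₁) ⟩
  + binomℤ n a * + binomℤ n b + (+ binomℤ n a * + binomℤ n b₁ + + binomℤ n a₁ * + binomℤ n b)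
    + + binomℤ n a₁ * + binomℤ n b₁
    ≡⟨ cong₂ _+_ (cong₂ _+_ (binomℤ-product n a b) (cong₂ _+_ (binomℤ-product n a b₁) (binomℤ-product n a₁ b)))
                 (binomℤ-product n a₁ b₁) ⟩
  expansion n s a + (expansion n (a + b₁) a + expansion n (a₁ + b) a₁) + expansion n (a₁ + b₁) a₁
    ≡⟨ cong₂ (λ u v → expansion n s a + (expansion n u a + expansion n v a₁) + expansion n (a₁ + b₁) a₁)
             (index₁ a b) (index₂ a b) ⟩
  expansion n s a + (expansion n (s - + 1) a + expansion n (s - + 1) a₁) + expansion n (a₁ + b₁) a₁
    ≡⟨ cong (λ u → expansion n s a + (expansion n (s - + 1) a + expansion n (s - + 1) a₁) + expansion n u a₁) (index₃ a b) ⟩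
  expansion n s a + (expansion n (s - + 1) a + expansion n (s - + 1) a₁) + expansion n (s - + 2) a₁
    ≡⟨ sym (expansion-suc n s a) ⟩
  expansion (suc n) s a
    ∎
  where
  a₁ b₁ s : ℤ
  a₁ = a - + 1
  b₁ = b - + 1
  s = a + b
  pascal : ∀ j → + binomℤ (suc n) j ≡ + binomℤ n j + + binomℤ n (j - + 1)
  pascal j = trans (cong +_ (binomℤ-pascal n j)) (ℤ.pos-+ (binomℤ n j) (binomℤ n (j - + 1)))
  expand : ∀ p q r t → (p + q) * (r + t) ≡ p * r + (p * t + q * r) + q * t
  expand = solve-∀
  index₁ : ∀ a b → a + (b - + 1) ≡ a + b - + 1
  index₁ = solve-∀
  index₂ : ∀ a b → a - + 1 + b ≡ a + b - + 1
  index₂ = solve-∀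
  index₃ : ∀ a b → a - + 1 + (b - + 1) ≡ a + b - + 2
  index₃ = solve-∀

-- Chebyshev polynomials

-- chebU n (cos x) = sin (n x) / sin x, a Chebyshev polynomial of the second kind.
chebU : ℕ → ℤ → ℤ
chebU zero          y = + 0
chebU (suc zero)    y = + 1
chebU (suc (suc n)) y = + 2 * y * chebU (suc n) y - chebU n y

chebUℤ : ℤ → ℤ → ℤ
chebUℤ (+ n)    y = chebU n y
chebUℤ -[1+ n ] y = - chebU (suc n) y

cheb-suc : ∀ n y → cheb (suc n) y ≡ y * cheb n y - (+ 1 - y * y) * chebU n y
cheb-suc zero          y = lemma y
  where
  lemma : ∀ y → y ≡ y * + 1 - (+ 1 - y * y) * + 0
  lemma = solve-∀
cheb-suc (suc zero)    y = lemma y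
  where
  lemma : ∀ y → + 2 * y * y - + 1 ≡ y * y - (+ 1 - y * y) * + 1
  lemma = solve-∀
cheb-suc (suc (suc n)) y = begin
  + 2 * y * cheb (suc (suc n)) y - cheb (suc n) y
    ≡⟨ cong₂ (λ u v → + 2 * y * u - v) (cheb-suc (suc n) y) (cheb-suc n y) ⟩
  + 2 * y * (y * cheb (suc n) y - (+ 1 - y * y) * chebU (suc n) y) - (y * cheb n y - (+ 1 - y * y) * chebU n y)
    ≡⟨ lemma y (cheb (suc n) y) (cheb n y) (chebU (suc n) y) (chebU n y) ⟩
  y * cheb (suc (suc n)) y - (+ 1 - y * y) * chebU (suc (suc n)) y
    ∎
  where
  lemma : ∀ y c₁ c₀ s₁ s₀ → + 2 * y * (y * c₁ - (+ 1 - y * y) * s₁) - (y * c₀ - (+ 1 - y * y) * s₀)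
                            ≡ y * (+ 2 * y * c₁ - c₀) - (+ 1 - y * y) * (+ 2 * y * s₁ - s₀)
  lemma = solve-∀

chebU-suc : ∀ n y → chebU (suc n) y ≡ y * chebU n y + cheb n y
chebU-suc zero          y = lemma y
  where
  lemma : ∀ y → + 1 ≡ y * + 0 + + 1
  lemma = solve-∀
chebU-suc (suc zero)    y = lemma y
  where
  lemma : ∀ y → + 2 * y * + 1 - + 0 ≡ y * + 1 + y
  lemma = solve-∀
chebU-suc (suc (suc n)) y = begin
  + 2 * y * chebU (suc (suc n)) y - chebU (suc n) y
    ≡⟨ cong₂ (λ u v → + 2 * y * u - v) (chebU-suc (suc n) y) (chebU-suc n y) ⟩
  + 2 * y * (y * chebU (suc n) y + cheb (suc n) y) - (y * chebU n y + cheb n y)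
    ≡⟨ lemma y (cheb (suc n) y) (cheb n y) (chebU (suc n) y) (chebU n y) ⟩
  y * chebU (suc (suc n)) y + cheb (suc (suc n)) y
    ∎
  where
  lemma : ∀ y c₁ c₀ s₁ s₀ → + 2 * y * (y * s₁ + c₁) - (y * s₀ + c₀)
                            ≡ y * (+ 2 * y * s₁ - s₀) + (+ 2 * y * c₁ - c₀)
  lemma = solve-∀

cheb-pred : ∀ n y → cheb n y ≡ y * cheb (suc n) y + (+ 1 - y * y) * chebU (suc n) y
cheb-pred n y = sym (trans (cong₂ (λ u v → y * u + (+ 1 - y * y) * v) (cheb-suc n y) (chebU-suc n y))
                           (lemma y (cheb n y) (chebU n y)))
  where
  lemma : ∀ y c s → y * (y * c - (+ 1 - y * y) * s) + (+ 1 - y * y) * (y * s + c) ≡ c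
  lemma = solve-∀

chebU-pred : ∀ n y → chebU n y ≡ y * chebU (suc n) y - cheb (suc n) y
chebU-pred n y = sym (trans (cong₂ (λ u v → y * u - v) (chebU-suc n y) (cheb-suc n y))
                            (lemma y (cheb n y) (chebU n y)))
  where
  lemma : ∀ y c s → y * (y * s + c) - (y * c - (+ 1 - y * y) * s) ≡ s
  lemma = solve-∀

cheb-1- : ∀ j y → cheb (∣ + 1 - j ∣) y ≡ y * cheb (∣ j ∣) y + (+ 1 - y * y) * chebUℤ j y
cheb-1- (+ zero)  y = lemma y
  where
  lemma : ∀ y → y ≡ y * + 1 + (+ 1 - y * y) * + 0
  lemma = solve-∀
cheb-1- (+ suc n) y = trans (cong (λ u → cheb u y) ∣1-[1+n]∣≡n) (cheb-pred n y)
  where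
  ∣1-[1+n]∣≡n : ∣ + 1 - + suc n ∣ ≡ n
  ∣1-[1+n]∣≡n = trans (cong ∣_∣ (trans (ℤ.m-n≡m⊖n 1 (suc n)) (ℤ.[1+m]⊖[1+n]≡m⊖n 0 n))) (ℤ.∣⊖∣-≤ z≤n)
cheb-1- -[1+ n ]  y = trans (cheb-suc (suc n) y) (lemma y (cheb (suc n) y) (chebU (suc n) y))
  where
  lemma : ∀ y c s → y * c - (+ 1 - y * y) * s ≡ y * c + (+ 1 - y * y) * (- s)
  lemma = solve-∀

chebUℤ-1- : ∀ j y → chebUℤ (+ 1 - j) y ≡ cheb (∣ j ∣) y - y * chebUℤ j y
chebUℤ-1- (+ zero)        y = lemma y
  where
  lemma : ∀ y → + 1 ≡ + 1 - y * + 0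
  lemma = solve-∀
chebUℤ-1- (+ suc zero)    y = lemma y
  where
  lemma : ∀ y → + 0 ≡ y - y * + 1
  lemma = solve-∀
chebUℤ-1- (+ suc (suc n)) y = trans (cong -_ (chebU-pred (suc n) y))
                                    (lemma y (cheb (suc (suc n)) y) (chebU (suc (suc n)) y))
  where
  lemma : ∀ y c s → - (y * s - c) ≡ c - y * s
  lemma = solve-∀
chebUℤ-1- -[1+ n ]        y = trans (chebU-suc (suc n) y) (lemma y (cheb (suc n) y) (chebU (suc n) y))
  where
  lemma : ∀ y c s → y * s + c ≡ c - y * (- s)
  lemma = solve-∀

chebUℤ-neg : ∀ l y → chebUℤ (- l) y ≡ - chebUℤ l y
chebUℤ-neg (+ zero)  y = refl
chebUℤ-neg (+ suc n) y = refl
chebUℤ-neg -[1+ n ]  y = sym (ℤ.neg-involutive _)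

cosKernel : ℤ → ℤ → ℤ
cosKernel y l = cheb ∣ l ∣ y

sinKernel : ℤ → ℤ → ℤ
sinKernel y l = chebUℤ l y

PositivePair : (ℤ → ℤ) → (ℤ → ℤ) → Set
PositivePair P R = IsPolyIn1+ P × IsPolyIn1+ (λ y → P y + (+ 1 - y) * R y)

PositivePair-resp : ∀ {P P′ R R′ : ℤ → ℤ} → (∀ y → P y ≡ P′ y) → (∀ y → R y ≡ R′ y) →
                    PositivePair P′ R′ → PositivePair P R
PositivePair-resp P≗P′ R≗R′ (P′-poly , Q′-poly) =
  IsPolyIn1+-resp P≗P′ P′-poly ,
  IsPolyIn1+-resp (λ y → cong₂ (λ u v → u + (+ 1 - y) * v) (P≗P′ y) (R≗R′ y)) Q′-poly

PositivePair-+ : ∀ {P₁ P₂ R₁ R₂ : ℤ → ℤ} → PositivePair P₁ R₁ → PositivePair P₂ R₂ →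
                 PositivePair (λ y → P₁ y + P₂ y) (λ y → R₁ y + R₂ y)
PositivePair-+ {P₁} {P₂} {R₁} {R₂} (P₁-poly , Q₁-poly) (P₂-poly , Q₂-poly) =
  IsPolyIn1+-+ P₁-poly P₂-poly ,
  IsPolyIn1+-resp (λ y → lemma y (P₁ y) (P₂ y) (R₁ y) (R₂ y)) (IsPolyIn1+-+ Q₁-poly Q₂-poly)
  where
  lemma : ∀ y p₁ p₂ r₁ r₂ → p₁ + p₂ + (+ 1 - y) * (r₁ + r₂) ≡ p₁ + (+ 1 - y) * r₁ + (p₂ + (+ 1 - y) * r₂)
  lemma = solve-∀

PositivePair-mirror : ∀ {P R : ℤ → ℤ} → IsPolyIn1+ P → PositivePair (λ y → P y + P y) (λ y → R y + - R y)
PositivePair-mirror {P} {R} P-poly =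
  IsPolyIn1+-resp (λ y → lemma₁ (P y)) twice , IsPolyIn1+-resp (λ y → lemma₂ y (P y) (R y)) twice
  where
  twice : IsPolyIn1+ (λ y → + 2 * P y)
  twice = IsPolyIn1+-scale 2 P-poly
  lemma₁ : ∀ p → p + p ≡ + 2 * p
  lemma₁ = solve-∀
  lemma₂ : ∀ y p r → p + p + (+ 1 - y) * (r + - r) ≡ + 2 * p
  lemma₂ = solve-∀

PositivePair-shift : ∀ {P R : ℤ → ℤ} → IsPolyIn1+ (λ y → P y + (+ 1 - y) * R y) →
  PositivePair (λ y → y * P y + (+ 1 - y * y) * R y + P y) (λ y → + 1 * P y + (- y) * R y + R y)
PositivePair-shift {P} {R} Q-poly =
  IsPolyIn1+-resp (λ y → lemma₁ y (P y) (R y)) (IsPolyIn1+-*1+ Q-poly) ,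
  IsPolyIn1+-resp (λ y → lemma₂ y (P y) (R y)) (IsPolyIn1+-scale 2 Q-poly)
  where
  lemma₁ : ∀ y p r → y * p + (+ 1 - y * y) * r + p ≡ (+ 1 + y) * (p + (+ 1 - y) * r)
  lemma₁ = solve-∀
  lemma₂ : ∀ y p r → y * p + (+ 1 - y * y) * r + p + (+ 1 - y) * (+ 1 * p + (- y) * r + r)
                     ≡ + 2 * (p + (+ 1 - y) * r)
  lemma₂ = solve-∀

PositivePair-const : ∀ c → PositivePair (λ _ → + c) (λ _ → + 0)
PositivePair-const c = poly (c ∷ []) (λ y → lemma₁ (+ c) y) , poly (c ∷ []) (λ y → lemma₂ (+ c) y)
  where
  lemma₁ : ∀ c y → c ≡ c + (+ 1 + y) * + 0
  lemma₁ = solve-∀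
  lemma₂ : ∀ c y → c + (+ 1 - y) * + 0 ≡ c + (+ 1 + y) * + 0
  lemma₂ = solve-∀

module _ (B : ℕ) (c : ℤ → ℕ) (y : ℤ) where

  weightedSum-linearʳ : ∀ a b κ₁ κ₂ →
    weightedSum B c (λ l → a * κ₁ l + b * κ₂ l) ≡ a * weightedSum B c κ₁ + b * weightedSum B c κ₂
  weightedSum-linearʳ a b κ₁ κ₂ = trans (weightedSum-+ʳ B c (λ l → a * κ₁ l) (λ l → b * κ₂ l))
                                        (cong₂ _+_ (weightedSum-*ʳ B c a κ₁) (weightedSum-*ʳ B c b κ₂))

  weightedSum-cosKernel-reflect : weightedSum B c (λ l → cosKernel y (- l)) ≡ weightedSum B c (cosKernel y)
  weightedSum-cosKernel-reflect = weightedSum-congʳ B c (λ l → cong (λ n → cheb n y) (ℤ.∣-i∣≡∣i∣ l))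

  weightedSum-sinKernel-reflect : weightedSum B c (λ l → sinKernel y (- l)) ≡ - weightedSum B c (sinKernel y)
  weightedSum-sinKernel-reflect = begin
    weightedSum B c (λ l → sinKernel y (- l))
      ≡⟨ weightedSum-congʳ B c (λ l → trans (chebUℤ-neg l y) (lemma (chebUℤ l y))) ⟩
    weightedSum B c (λ l → - + 1 * sinKernel y l)    ≡⟨ weightedSum-*ʳ B c (- + 1) (sinKernel y) ⟩
    - + 1 * weightedSum B c (sinKernel y)            ≡⟨ sym (lemma (weightedSum B c (sinKernel y))) ⟩
    - weightedSum B c (sinKernel y)                  ∎
    where
    lemma : ∀ s → - s ≡ - + 1 * s
    lemma = solve-∀

  weightedSum-cosKernel-1- : weightedSum B c (λ l → cosKernel y (+ 1 - l))
                             ≡ y * weightedSum B c (cosKernel y) + (+ 1 - y * y) * weightedSum B c (sinKernel y)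
  weightedSum-cosKernel-1- = trans (weightedSum-congʳ B c (λ l → cheb-1- l y))
                                   (weightedSum-linearʳ y (+ 1 - y * y) (cosKernel y) (sinKernel y))

  weightedSum-sinKernel-1- : weightedSum B c (λ l → sinKernel y (+ 1 - l))
                             ≡ + 1 * weightedSum B c (cosKernel y) + (- y) * weightedSum B c (sinKernel y)
  weightedSum-sinKernel-1- = trans (weightedSum-congʳ B c (λ l → trans (chebUℤ-1- l y) (lemma y (cosKernel y l) (sinKernel y l))))
                                   (weightedSum-linearʳ (+ 1) (- y) (cosKernel y) (sinKernel y))
    where
    lemma : ∀ y t s → t - y * s ≡ + 1 * t + (- y) * s
    lemma = solve-∀

-- Positivity of the binomial cosine sums

m+m≤n⇒m<n : ∀ {m n} → 0 < n → m ℕ.+ m ≤ n → m < n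
m+m≤n⇒m<n {zero}  0<n _       = 0<n
m+m≤n⇒m<n {suc m} _   2m+2≤n = ℕ.<-≤-trans (ℕ.m<m+n (suc m) ℕ.z<s) 2m+2≤n

m+m≤n+n⇒m≤n : ∀ {m n} → m ℕ.+ m ≤ n ℕ.+ n → m ≤ n
m+m≤n+n⇒m≤n 2m≤2n = ℕ.≮⇒≥ (λ n<m → ℕ.<⇒≱ (ℕ.+-mono-< n<m n<m) 2m≤2n)

halved-bounds : ∀ {i A a b m k} → i ℕ.+ A ≡ a → (i ℕ.+ i) ℕ.+ m ≡ a ℕ.+ b → b ≤ a → a ≤ b ℕ.+ k →
                m ≤ A ℕ.+ A × A ℕ.+ A ≤ m ℕ.+ k
halved-bounds {i} {A} {a} {b} {m} {k} refl 2i+m≡a+b b≤a a≤b+k =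
  ℕ.+-cancelˡ-≤ (i ℕ.+ i) m (A ℕ.+ A)
    (ℕ.≤-trans (ℕ.≤-reflexive 2i+m≡a+b) (ℕ.≤-trans (ℕ.+-monoʳ-≤ a b≤a) (ℕ.≤-reflexive (regroup i A)))) ,
  ℕ.+-cancelˡ-≤ (i ℕ.+ i) (A ℕ.+ A) (m ℕ.+ k)
    (ℕ.≤-trans (ℕ.≤-reflexive (sym (regroup i A))) (ℕ.≤-trans (ℕ.+-monoʳ-≤ a a≤b+k) (ℕ.≤-reflexive a+[b+k]≡2i+[m+k])))
  where
  a+[b+k]≡2i+[m+k] : a ℕ.+ (b ℕ.+ k) ≡ i ℕ.+ i ℕ.+ (m ℕ.+ k)
  a+[b+k]≡2i+[m+k] = trans (sym (ℕ.+-assoc a b k)) (trans (cong (ℕ._+ k) (sym 2i+m≡a+b)) (ℕ.+-assoc (i ℕ.+ i) m k))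
  regroup : ∀ i A → (i ℕ.+ A) ℕ.+ (i ℕ.+ A) ≡ (i ℕ.+ i) ℕ.+ (A ℕ.+ A)
  regroup = ℕ-solve-∀

distance-bound : ∀ {x y k} → x ≤ y → ∣ + x - + y ∣ ≤ k → y ≤ x ℕ.+ k
distance-bound {x} {y} {k} x≤y d≤k = subst (_≤ x ℕ.+ k) (ℕ.m+[n∸m]≡n x≤y) (ℕ.+-monoʳ-≤ x (subst (_≤ k) d≡y∸x d≤k))
  where
  d≡y∸x : ∣ + x - + y ∣ ≡ y ℕ.∸ x
  d≡y∸x = trans (cong ∣_∣ (ℤ.m-n≡m⊖n x y)) (ℤ.∣⊖∣-≤ x≤y)

cosSum-cong : ∀ L {c d} → (∀ l → c l ≡ d l) → ∀ y → cosSum L c y ≡ cosSum L d y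
cosSum-cong L {c} {d} c≗d y = trans (cosSum≡weightedSum L c y)
  (trans (weightedSum-congˡ L (cosKernel y) c≗d) (sym (cosSum≡weightedSum L d y)))

cosSum-reflect : ∀ L c y → cosSum L (λ l → c (- l)) y ≡ cosSum L c y
cosSum-reflect L c y = trans (cosSum≡weightedSum L (λ l → c (- l)) y)
  (trans (weightedSum-reflect L c (cosKernel y)) (trans (weightedSum-cosKernel-reflect L c y) (sym (cosSum≡weightedSum L c y))))

IsPolyIn1+cos-resp : ∀ L {c d} → (∀ l → c l ≡ d l) → IsPolyIn1+cos L d → IsPolyIn1+cos L c
IsPolyIn1+cos-resp L c≗d (ps , d≡ps) = ps , λ y → trans (cosSum-cong L c≗d y) (d≡ps y)

IsPolyIn1+cos-reflect : ∀ L c → IsPolyIn1+cos L c → IsPolyIn1+cos L (λ l → c (- l))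
IsPolyIn1+cos-reflect L c (ps , c≡ps) = ps , λ y → trans (cosSum-reflect L c y) (c≡ps y)

module _ (k : ℕ) (1≤k : 1 ≤ k) where

  private instance
    k-nonZero : ℕ.NonZero k
    k-nonZero = ℕ.>-nonZero 1≤k

  coeff : ℕ → ℤ → ℤ → ℕ
  coeff m a l = binomℤ m (a - + k * l)

  coeff-pascal : ∀ m a l → coeff (suc m) a l ≡ coeff m a l ℕ.+ coeff m (a - + 1) l
  coeff-pascal m a l = trans (binomℤ-pascal m (a - + k * l)) (cong (λ j → coeff m a l ℕ.+ binomℤ m j) (lemma a (+ k) l))
    where
    lemma : ∀ a k l → a - k * l - + 1 ≡ a - + 1 - k * l
    lemma = solve-∀

  coeff-reflect : ∀ m a l → coeff m a (- l) ≡ coeff m (+ m - a) l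
  coeff-reflect m a l = trans (binomℤ-sym m (a - + k * - l)) (cong (binomℤ m) (lemma (+ m) a (+ k) l))
    where
    lemma : ∀ m a k l → m - (a - k * - l) ≡ m - a - k * l
    lemma = solve-∀

  coeff-reflect-shift : ∀ m a l → coeff m a l ≡ coeff m (+ m - a + + k) (+ 1 - l)
  coeff-reflect-shift m a l = trans (binomℤ-sym m (a - + k * l)) (cong (binomℤ m) (lemma (+ m) a (+ k) l))
    where
    lemma : ∀ m a k l → m - (a - k * l) ≡ m - a + k - k * (+ 1 - l)
    lemma = solve-∀

  coeff-supported : ∀ {m A B} → A < k ℕ.* suc B → m < A ℕ.+ k ℕ.* suc B → Supported B (coeff m (+ A))
  coeff-supported {m} {A} {B} A<k[1+B] m<A+k[1+B] (+ t) B<t = begin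
    binomℤ m (+ A - + k * + t)   ≡⟨ cong (λ j → binomℤ m (+ A - j)) (sym (ℤ.pos-* k t)) ⟩
    binomℤ m (+ A - + (k ℕ.* t)) ≡⟨ binomℤ-below m (ℕ.<-≤-trans A<k[1+B] (ℕ.*-monoʳ-≤ k B<t)) ⟩
    0                            ∎
  coeff-supported {m} {A} {B} A<k[1+B] m<A+k[1+B] -[1+ t ] B<1+t = begin
    binomℤ m (+ A - + k * -[1+ t ])
      ≡⟨ cong (binomℤ m) index ⟩
    binomℤ m (+ (A ℕ.+ k ℕ.* suc t))
      ≡⟨ binomℤ-above m (ℕ.<-≤-trans m<A+k[1+B] (ℕ.+-monoʳ-≤ A (ℕ.*-monoʳ-≤ k B<1+t))) ⟩
    0
      ∎
    where
    lemma : ∀ a k s → a - k * (- s) ≡ a + k * s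
    lemma = solve-∀
    index : + A - + k * -[1+ t ] ≡ + (A ℕ.+ k ℕ.* suc t)
    index = trans (lemma (+ A) (+ k) (+ suc t)) (cong (λ j → + A + j) (sym (ℤ.pos-* k (suc t))))

  coeff-supported-self : ∀ {m A} → m ≤ A ℕ.+ A → Supported A (coeff m (+ A))
  coeff-supported-self {m} {A} m≤2A =
    coeff-supported A<k[1+A] (ℕ.<-≤-trans (ℕ.≤-<-trans m≤2A (ℕ.+-monoʳ-< A (ℕ.n<1+n A))) (ℕ.+-monoʳ-≤ A k[1+A]))
    where
    k[1+A] : suc A ≤ k ℕ.* suc A
    k[1+A] = ℕ.m≤n*m (suc A) k
    A<k[1+A] : A < k ℕ.* suc A
    A<k[1+A] = ℕ.<-≤-trans (ℕ.n<1+n A) k[1+A]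

  binomialSum : ℕ → ℕ → (ℤ → ℤ) → ℤ
  binomialSum m A κ = weightedSum A (coeff m (+ A)) κ

  binomialSum-pascal : ∀ {m A} → m ≤ A ℕ.+ A → ∀ κ →
    binomialSum (suc m) (suc A) κ ≡ binomialSum m (suc A) κ + binomialSum m A κ
  binomialSum-pascal {m} {A} m≤2A κ = begin
    binomialSum (suc m) (suc A) κ
      ≡⟨ weightedSum-congˡ (suc A) κ (coeff-pascal m (+ suc A)) ⟩
    weightedSum (suc A) (λ l → coeff m (+ suc A) l ℕ.+ coeff m (+ A) l) κ
      ≡⟨ weightedSum-+ˡ (suc A) (coeff m (+ suc A)) (coeff m (+ A)) κ ⟩
    binomialSum m (suc A) κ + weightedSum (suc A) (coeff m (+ A)) κ
      ≡⟨ cong (λ s → binomialSum m (suc A) κ + s) (weightedSum-extend κ (coeff-supported-self m≤2A) (ℕ.n≤1+n A)) ⟩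
    binomialSum m (suc A) κ + binomialSum m A κ
      ∎

  binomialSum-mirror : ∀ {m A} → suc A ℕ.+ A ≡ m → ∀ κ →
    binomialSum (suc m) (suc A) κ ≡ binomialSum m (suc A) κ + binomialSum m (suc A) (λ l → κ (- l))
  binomialSum-mirror {m} {A} 2A+1≡m κ = begin
    binomialSum (suc m) (suc A) κ
      ≡⟨ weightedSum-congˡ (suc A) κ (coeff-pascal m (+ suc A)) ⟩
    weightedSum (suc A) (λ l → coeff m (+ suc A) l ℕ.+ coeff m (+ A) l) κ
      ≡⟨ weightedSum-+ˡ (suc A) (coeff m (+ suc A)) (coeff m (+ A)) κ ⟩
    binomialSum m (suc A) κ + weightedSum (suc A) (coeff m (+ A)) κ
      ≡⟨ cong (λ s → binomialSum m (suc A) κ + s) (weightedSum-congˡ (suc A) κ reflected) ⟩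
    binomialSum m (suc A) κ + weightedSum (suc A) (λ l → coeff m (+ suc A) (- l)) κ
      ≡⟨ cong (λ s → binomialSum m (suc A) κ + s) (weightedSum-reflect (suc A) (coeff m (+ suc A)) κ) ⟩
    binomialSum m (suc A) κ + binomialSum m (suc A) (λ l → κ (- l))
      ∎
    where
    reflected : ∀ l → coeff m (+ A) l ≡ coeff m (+ suc A) (- l)
    reflected l = sym (trans (coeff-reflect m (+ suc A) l) (cong (λ a → coeff m a l) (x+y≡z⇒+z-+x≡+y 2A+1≡m)))

  binomialSum-shift : ∀ {m A} → m ≤ A ℕ.+ A → suc A ℕ.+ A ≡ m ℕ.+ k → ∀ κ →
    binomialSum (suc m) (suc A) κ ≡ binomialSum m A (λ l → κ (+ 1 - l)) + binomialSum m A κ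
  binomialSum-shift {m} {A} m≤2A 2A+1≡m+k κ = begin
    binomialSum (suc m) (suc A) κ
      ≡⟨ weightedSum-congˡ (suc A) κ (λ l → trans (coeff-pascal m (+ suc A) l) (cong (ℕ._+ coeff m (+ A) l) (shifted l))) ⟩
    weightedSum (suc A) (λ l → coeff m (+ A) (+ 1 - l) ℕ.+ coeff m (+ A) l) κ
      ≡⟨ weightedSum-+ˡ (suc A) (λ l → coeff m (+ A) (+ 1 - l)) (coeff m (+ A)) κ ⟩
    weightedSum (suc A) (λ l → coeff m (+ A) (+ 1 - l)) κ + weightedSum (suc A) (coeff m (+ A)) κ
      ≡⟨ cong₂ _+_ (weightedSum-reflect-shift κ supported) (weightedSum-extend κ supported (ℕ.n≤1+n A)) ⟩
    binomialSum m A (λ l → κ (+ 1 - l)) + binomialSum m A κ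
      ∎
    where
    supported : Supported A (coeff m (+ A))
    supported = coeff-supported-self m≤2A
    lemma : ∀ m a k → m - a + k ≡ m + k - a
    lemma = solve-∀
    index : + m - + suc A + + k ≡ + A
    index = trans (lemma (+ m) (+ suc A) (+ k)) (trans (cong (_- + suc A) (sym (ℤ.pos-+ m k))) (x+y≡z⇒+z-+x≡+y 2A+1≡m+k))
    shifted : ∀ l → coeff m (+ suc A) l ≡ coeff m (+ A) (+ 1 - l)
    shifted l = trans (coeff-reflect-shift m (+ suc A) l) (cong (λ a → coeff m a (+ 1 - l)) index)

  CosSinPositive : ℕ → ℕ → Set
  CosSinPositive m A = PositivePair (λ y → binomialSum m A (cosKernel y)) (λ y → binomialSum m A (sinKernel y))

  positivity-base : ∀ A → A ℕ.+ A ≤ k → CosSinPositive 0 A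
  positivity-base A 2A≤k = PositivePair-resp
    (λ y → trans (at-origin (cosKernel y)) (ℤ.*-identityʳ (+ c₀)))
    (λ y → trans (at-origin (sinKernel y)) (ℤ.*-zeroʳ (+ c₀)))
    (PositivePair-const c₀)
    where
    c₀ : ℕ
    c₀ = coeff 0 (+ A) (+ 0)
    supported : Supported 0 (coeff 0 (+ A))
    supported = coeff-supported (ℕ.<-≤-trans (m+m≤n⇒m<n 1≤k 2A≤k) (ℕ.≤-reflexive (sym (ℕ.*-identityʳ k))))
                                (ℕ.<-≤-trans (ℕ.<-≤-trans 1≤k (ℕ.m≤m*n k 1)) (ℕ.m≤n+m (k ℕ.* 1) A))
    at-origin : ∀ κ → binomialSum 0 A κ ≡ + c₀ * κ (+ 0)
    at-origin κ = weightedSum-extend {B′ = A} κ supported z≤n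

  positivity-pascal : ∀ m A → m ≤ A ℕ.+ A → CosSinPositive m (suc A) → CosSinPositive m A → CosSinPositive (suc m) (suc A)
  positivity-pascal m A m≤2A IH₁ IH₂ = PositivePair-resp
    (λ y → binomialSum-pascal {m} {A} m≤2A (cosKernel y))
    (λ y → binomialSum-pascal {m} {A} m≤2A (sinKernel y))
    (PositivePair-+ IH₁ IH₂)

  positivity-mirror : ∀ m A → suc A ℕ.+ A ≡ m → CosSinPositive m (suc A) → CosSinPositive (suc m) (suc A)
  positivity-mirror m A 2A+1≡m IH = PositivePair-resp
    (λ y → trans (binomialSum-mirror {m} {A} 2A+1≡m (cosKernel y))
                 (cong (λ s → binomialSum m (suc A) (cosKernel y) + s) (weightedSum-cosKernel-reflect (suc A) (coeff m (+ suc A)) y)))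
    (λ y → trans (binomialSum-mirror {m} {A} 2A+1≡m (sinKernel y))
                 (cong (λ s → binomialSum m (suc A) (sinKernel y) + s) (weightedSum-sinKernel-reflect (suc A) (coeff m (+ suc A)) y)))
    (PositivePair-mirror {R = λ y → binomialSum m (suc A) (sinKernel y)} (proj₁ IH))

  positivity-shift : ∀ m A → m ≤ A ℕ.+ A → suc A ℕ.+ A ≡ m ℕ.+ k → CosSinPositive m A → CosSinPositive (suc m) (suc A)
  positivity-shift m A m≤2A 2A+1≡m+k IH = PositivePair-resp
    (λ y → trans (binomialSum-shift {m} {A} m≤2A 2A+1≡m+k (cosKernel y))
                 (cong (_+ binomialSum m A (cosKernel y)) (weightedSum-cosKernel-1- A (coeff m (+ A)) y)))
    (λ y → trans (binomialSum-shift {m} {A} m≤2A 2A+1≡m+k (sinKernel y))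
                 (cong (_+ binomialSum m A (sinKernel y)) (weightedSum-sinKernel-1- A (coeff m (+ A)) y)))
    (PositivePair-shift (proj₂ IH))

  positivity : ∀ m A → m ≤ A ℕ.+ A → A ℕ.+ A ≤ m ℕ.+ k → CosSinPositive m A
  positivity zero    A       _      2A≤k     = positivity-base A 2A≤k
  positivity (suc m) (suc A) 1+m≤2A 2A≤1+m+k with ℕ.m≤n⇒m<n∨m≡n 1+m≤2A | ℕ.m≤n⇒m<n∨m≡n 2A≤1+m+k
  ... | inj₂ 1+m≡2A | _ =
    positivity-mirror m A (sym (trans (ℕ.suc-injective 1+m≡2A) (ℕ.+-suc A A)))
                      (positivity m (suc A) (ℕ.<⇒≤ 1+m≤2A) 2A≤m+k)
    where
    2A≤m+k : suc A ℕ.+ suc A ≤ m ℕ.+ k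
    2A≤m+k = ℕ.≤-trans (ℕ.≤-reflexive (sym 1+m≡2A)) (ℕ.≤-trans (ℕ.≤-reflexive (ℕ.+-comm 1 m)) (ℕ.+-monoʳ-≤ m 1≤k))
  ... | inj₁ 1+m<2A | inj₂ 2A≡1+m+k =
    positivity-shift m A m≤2A 2A+1≡m+k (positivity m A m≤2A (ℕ.≤-trans (ℕ.n≤1+n (A ℕ.+ A)) (ℕ.≤-reflexive 2A+1≡m+k)))
    where
    m≤2A : m ≤ A ℕ.+ A
    m≤2A = ℕ.s≤s⁻¹ (ℕ.≤-trans (ℕ.s≤s⁻¹ 1+m<2A) (ℕ.≤-reflexive (ℕ.+-suc A A)))
    2A+1≡m+k : suc A ℕ.+ A ≡ m ℕ.+ k
    2A+1≡m+k = trans (sym (ℕ.+-suc A A)) (ℕ.suc-injective 2A≡1+m+k)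
  ... | inj₁ 1+m<2A | inj₁ 2A<1+m+k =
    positivity-pascal m A m≤2A (positivity m (suc A) (ℕ.<⇒≤ (ℕ.<-trans (ℕ.n<1+n m) 1+m<2A)) (ℕ.s≤s⁻¹ 2A<1+m+k))
                           (positivity m A m≤2A (ℕ.≤-trans (ℕ.+-mono-≤ (ℕ.n≤1+n A) (ℕ.n≤1+n A)) (ℕ.s≤s⁻¹ 2A<1+m+k)))
    where
    m≤2A : m ≤ A ℕ.+ A
    m≤2A = ℕ.s≤s⁻¹ (ℕ.≤-trans (ℕ.s≤s⁻¹ 1+m<2A) (ℕ.≤-reflexive (ℕ.+-suc A A)))

  expansion-term-positive : ∀ n a b i → b ≤ a → a ≤ b ℕ.+ k → a ≤ n →
    IsPolyIn1+ (λ y → weightedSum n (λ l → binomℤℤ (+ a + + b - (+ i + + i)) (+ a - + k * l - + i)) (cosKernel y))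
  expansion-term-positive n a b i b≤a a≤b+k a≤n with (i ℕ.+ i) ≤? (a ℕ.+ b)
  ... | no 2i≰a+b = IsPolyIn1+-resp (λ y → weightedSum-zero n (cosKernel y) vanish) IsPolyIn1+-0
    where
    vanish : ∀ l → binomℤℤ (+ a + + b - (+ i + + i)) (+ a - + k * l - + i) ≡ 0
    vanish l = cong (λ v → binomℤℤ v (+ a - + k * l - + i)) (x<y⇒+x-+y≡-[1+y∸1+x] (ℕ.≰⇒> 2i≰a+b))
  ... | yes 2i≤a+b = IsPolyIn1+-resp as-binomialSum (proj₁ (positivity m A m≤2A 2A≤m+k))
    where
    A m : ℕ
    A = a ℕ.∸ i
    m = (a ℕ.+ b) ℕ.∸ (i ℕ.+ i)
    i+A≡a : i ℕ.+ A ≡ a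
    i+A≡a = ℕ.m+[n∸m]≡n (m+m≤n+n⇒m≤n {i} (ℕ.≤-trans 2i≤a+b (ℕ.+-monoʳ-≤ a b≤a)))
    2i+m≡a+b : (i ℕ.+ i) ℕ.+ m ≡ a ℕ.+ b
    2i+m≡a+b = ℕ.m+[n∸m]≡n 2i≤a+b
    m≤2A : m ≤ A ℕ.+ A
    m≤2A = proj₁ (halved-bounds {i} {A} i+A≡a 2i+m≡a+b b≤a a≤b+k)
    2A≤m+k : A ℕ.+ A ≤ m ℕ.+ k
    2A≤m+k = proj₂ (halved-bounds {i} {A} i+A≡a 2i+m≡a+b b≤a a≤b+k)
    index-swap : ∀ a x i → a - x - i ≡ a - i - x
    index-swap = solve-∀
    as-coeff : ∀ l → binomℤℤ (+ a + + b - (+ i + + i)) (+ a - + k * l - + i) ≡ coeff m (+ A) l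
    as-coeff l = cong₂ binomℤℤ (x+y≡z⇒+z-+x≡+y 2i+m≡a+b)
                               (trans (index-swap (+ a) (+ k * l) (+ i)) (cong (_- + k * l) (x+y≡z⇒+z-+x≡+y i+A≡a)))
    as-binomialSum : ∀ y → weightedSum n (λ l → binomℤℤ (+ a + + b - (+ i + + i)) (+ a - + k * l - + i)) (cosKernel y)
                           ≡ binomialSum m A (cosKernel y)
    as-binomialSum y = trans (weightedSum-congˡ n (cosKernel y) as-coeff)
                             (weightedSum-extend (cosKernel y) (coeff-supported-self m≤2A) (ℕ.≤-trans (ℕ.m∸n≤m a i) a≤n))

  product-positive : ∀ n a b → b ≤ a → a ≤ b ℕ.+ k → a ≤ n →
    IsPolyIn1+cos n (λ l → binomℤ n (+ a - + k * l) ℕ.* binomℤ n (+ b + + k * l))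
  product-positive n a b b≤a a≤b+k a≤n = IsPolyIn1+.coefficients positive , IsPolyIn1+.evaluation positive
    where
    c : ℤ → ℕ
    c l = binomℤ n (+ a - + k * l) ℕ.* binomℤ n (+ b + + k * l)
    w : ℕ → ℕ
    w i = trinomial n (+ a + + b) i
    h : ℕ → ℤ → ℕ
    h i l = binomℤℤ (+ a + + b - (+ i + + i)) (+ a - + k * l - + i)
    index-sum : ∀ a b x → a - x + (b + x) ≡ a + b
    index-sum = solve-∀
    c≡Σ : ∀ l → + c l ≡ sumℕ (suc n) (λ i → + w i * + h i l)
    c≡Σ l = trans (ℤ.pos-* (binomℤ n (+ a - + k * l)) (binomℤ n (+ b + + k * l)))
                  (trans (binomℤ-product n (+ a - + k * l) (+ b + + k * l))
                         (cong (λ s → expansion n s (+ a - + k * l)) (index-sum (+ a) (+ b) (+ k * l))))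
    positive : IsPolyIn1+ (cosSum n c)
    positive = IsPolyIn1+-resp (λ y → trans (cosSum≡weightedSum n c y) (weightedSum-expand n (suc n) w h (cosKernel y) c≡Σ))
                               (IsPolyIn1+-sumℕ (suc n) w (λ i → expansion-term-positive n a b i b≤a a≤b+k a≤n))

  mixed-products-positive : ∀ M N →
    IsPolyIn1+cos (M ℕ.+ N) (λ l → binomℤ (M ℕ.+ N) (+ M - + k * l) ℕ.* binomℤ (M ℕ.+ N) (+ N - + k * l))
  mixed-products-positive M N = IsPolyIn1+cos-resp (M ℕ.+ N)
    (λ l → cong (binomℤ (M ℕ.+ N) (+ M - + k * l) ℕ.*_) (binomℤ-complement (ℕ.+-comm N M) (+ k * l)))
    (product-positive (M ℕ.+ N) M M ℕ.≤-refl (ℕ.m≤m+n M k) (ℕ.m≤m+n M N))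

  squares-positive : ∀ M N → ∣ + M - + N ∣ ≤ k →
    IsPolyIn1+cos (M ℕ.+ N) (λ l → binomℤ (M ℕ.+ N) (+ M - + k * l) ℕ.* binomℤ (M ℕ.+ N) (+ M - + k * l))
  squares-positive M N d≤k with N ≤? M
  ... | yes N≤M = IsPolyIn1+cos-resp n
    (λ l → cong (binomℤ n (+ M - + k * l) ℕ.*_) (M-kl≡N+kl l))
    (product-positive n M N N≤M (distance-bound N≤M (subst (_≤ k) (ℤ.∣i-j∣≡∣j-i∣ (+ M) (+ N)) d≤k)) (ℕ.m≤m+n M N))
    where
    n : ℕ
    n = M ℕ.+ N
    M-kl≡N+kl : ∀ l → binomℤ n (+ M - + k * l) ≡ binomℤ n (+ N + + k * l)
    M-kl≡N+kl l = binomℤ-complement refl (+ k * l)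
  ... | no N≰M = IsPolyIn1+cos-resp n reflected
    (IsPolyIn1+cos-reflect n swapped (product-positive n N M M≤N (distance-bound M≤N d≤k) (ℕ.m≤n+m N M)))
    where
    n : ℕ
    n = M ℕ.+ N
    M≤N : M ≤ N
    M≤N = ℕ.<⇒≤ (ℕ.≰⇒> N≰M)
    swapped : ℤ → ℕ
    swapped l = binomℤ n (+ N - + k * l) ℕ.* binomℤ n (+ M + + k * l)
    index₁ : ∀ a x l → a - x * - l ≡ a + x * l
    index₁ = solve-∀
    index₂ : ∀ a x l → a + x * - l ≡ a - x * l
    index₂ = solve-∀
    reflected : ∀ l → binomℤ n (+ M - + k * l) ℕ.* binomℤ n (+ M - + k * l) ≡ swapped (- l)
    reflected l = sym (cong₂ ℕ._*_
      (trans (cong (binomℤ n) (index₁ (+ N) (+ k) l)) (sym (binomℤ-complement refl (+ k * l))))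
      (cong (binomℤ n) (index₂ (+ M) (+ k) l)))

theorem1p1 : (M N k : ℕ) → 1 ≤ k →
    (∣ + M - + N ∣ ≤ k →
      IsPolyIn1+cos (M ℕ.+ N) (λ l → binomℤ (M ℕ.+ N) (+ M - + k * l) ℕ.* binomℤ (M ℕ.+ N) (+ M - + k * l)))
    × IsPolyIn1+cos (M ℕ.+ N) (λ l → binomℤ (M ℕ.+ N) (+ M - + k * l) ℕ.* binomℤ (M ℕ.+ N) (+ N - + k * l))
theorem1p1 M N k 1≤k = squares-positive k 1≤k M N , mixed-products-positive k 1≤k M N
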